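{- The n-shuffle product $\overline{\sqcup\!\!\sqcup}$ on $\mathfrak{H}$ is commutative and associative.
   Context: Let $\mathfrak{H}=\mathbb{Q}\langle x,y\rangle$ be the noncommutative polynomial ring in $x,y$. The n-shuffle product $\overline{\sqcup\!\!\sqcup}$ on $\mathfrak{H}$ is the $\mathbb{Q}$-bilinear product defined inductively by $1\,\overline{\sqcup\!\!\sqcup}\,w=w\,\overline{\sqcup\!\!\sqcup}\,1=w$ and $u_1w_1\,\overline{\sqcup\!\!\sqcup}\,u_2w_2=u_1(w_1\,\overline{\sqcup\!\!\sqcup}\,u_2w_2)+u_2(u_1w_1\,\overline{\sqcup\!\!\sqcup}\,w_2)-\delta(w_1)\tau(u_1)u_2w_2-\delta(w_2)\tau(u_2)u_1w_1$ for letters $u_1,u_2\in\{x,y\}$ and words $w,w_1,w_2\in\mathfrak{H}$, where $\delta(w)=1$ if $w=1$ and $\delta(w)=0$ otherwise, and $\tau(x)=y$, $\tau(y)=x$. -}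

module Defs where

open import Data.Rational using (ℚ; 0ℚ; 1ℚ; _+_; _*_; -_)
open import Data.List using (List; []; _∷_; _++_; map; concatMap)
open import Data.Product using (_×_; _,_)
open import Relation.Binary.PropositionalEquality using (_≡_)
open import Relation.Nullary using (yes; no)

data Letter : Set where
  x y : Letter

τ : Letter → Letter
τ x = y
τ y = x

Word : Set
Word = List Letter

_≟L_ : (a b : Letter) → Relation.Nullary.Dec (a ≡ b)
x ≟L x = yes Relation.Binary.PropositionalEquality.refl
x ≟L y = no (λ ())
y ≟L x = no (λ ())
y ≟L y = yes Relation.Binary.PropositionalEquality.refl

_≟W_ : (u v : Word) → Relation.Nullary.Dec (u ≡ v)
[] ≟W [] = yes Relation.Binary.PropositionalEquality.refl
[] ≟W (_ ∷ _) = no (λ ())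
(_ ∷ _) ≟W [] = no (λ ())
(a ∷ u) ≟W (b ∷ v) with a ≟L b | u ≟W v
... | yes Relation.Binary.PropositionalEquality.refl | yes Relation.Binary.PropositionalEquality.refl = yes Relation.Binary.PropositionalEquality.refl
... | no a≢b | _ = no (λ { Relation.Binary.PropositionalEquality.refl → a≢b Relation.Binary.PropositionalEquality.refl })
... | yes _ | no u≢v = no (λ { Relation.Binary.PropositionalEquality.refl → u≢v Relation.Binary.PropositionalEquality.refl })

-- Elements of ℌ: finite formal ℚ-linear combinations of words,
-- represented by lists of (coefficient, word) terms (not normalised).
ℌ : Set
ℌ = List (ℚ × Word)

coeff : ℌ → Word → ℚ
coeff [] w = 0ℚ
coeff ((c , v) ∷ p) w with v ≟W w
... | yes _ = c + coeff p w
... | no _  = coeff p w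

infix 4 _≈_
_≈_ : ℌ → ℌ → Set
p ≈ q = ∀ w → coeff p w ≡ coeff q w

word : Word → ℌ
word w = (1ℚ , w) ∷ []

scale : ℚ → ℌ → ℌ
scale c = map (λ { (d , v) → (c * d , v) })

neg : ℌ → ℌ
neg = scale (- 1ℚ)

lmul : Letter → ℌ → ℌ
lmul a = map (λ { (d , v) → (d , a ∷ v) })

-- n-shuffle of words, following the inductive definition:
--  1 ⧢ w = w ⧢ 1 = w,
--  u₁w₁ ⧢ u₂w₂ = u₁(w₁ ⧢ u₂w₂) + u₂(u₁w₁ ⧢ w₂)
--               - δ(w₁) τ(u₁) u₂ w₂ - δ(w₂) τ(u₂) u₁ w₁.
δterm : Word → Word → ℌ
δterm [] v = word v
δterm (_ ∷ _) v = []

-- shAux a w₁ f v  computes  (a w₁) ⧢ v  given  f = (w₁ ⧢ -)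
shAux : Letter → Word → (Word → ℌ) → Word → ℌ
shAux a w₁ f [] = word (a ∷ w₁)
shAux a w₁ f (b ∷ w₂) =
  lmul a (f (b ∷ w₂)) ++ lmul b (shAux a w₁ f w₂)
  ++ neg (δterm w₁ (τ a ∷ b ∷ w₂)) ++ neg (δterm w₂ (τ b ∷ a ∷ w₁))

shW : Word → Word → ℌ
shW [] v = word v
shW (a ∷ w₁) v = shAux a w₁ (shW w₁) v

infixl 7 _⧢_
_⧢_ : ℌ → ℌ → ℌ
p ⧢ q = concatMap (λ { (c , u) → concatMap (λ { (d , v) → scale (c * d) (shW u v) }) q }) p

module Submission where

-- Associativity is the dendriform (Zinbiel) argument.  With the left
-- half-shuffle aU ≺ Q = a(U ⧢ Q) − δ(U) τ(a) Q, nonempty words satisfy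
-- u ⧢ v = u ≺ v + v ≺ u and (u ≺ v) ≺ t = u ≺ (v ⧢ t) (given associativity for
-- a shorter triple), whence (u ⧢ v) ⧢ t = u ≺ (v ⧢ t) + v ≺ (u ⧢ t) + t ≺ (u ⧢ v),
-- a symmetric expression; induction on total length and bilinearity finish.

open import Defs
open import Data.Product using (_×_; _,_)
open import Data.Rational using (ℚ; 0ℚ; 1ℚ; _+_; _*_; -_)
open import Data.Rational.Properties
  using (+-assoc; +-comm; +-identityˡ; *-zeroˡ; *-zeroʳ; *-identityˡ; *-identityʳ;
         *-distribˡ-+; *-distribʳ-+; *-assoc; *-comm)
open import Data.List using ([]; _∷_; _++_; concatMap; length)
import Data.List.Properties as List
open import Data.Nat as ℕ using (suc; _≤_; z≤n; s≤s)
open import Data.Nat.Properties using (≤-refl; ≤-trans; m≤n⇒m≤1+n; +-mono-≤)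
import Data.Nat.Tactic.RingSolver as ℕ-Solver
open import Relation.Nullary using (yes; no; ¬_; Dec; contradiction)
open import Relation.Binary.PropositionalEquality
open import Relation.Binary.Bundles using (Setoid)
open import Relation.Binary.Structures using (IsEquivalence)
open import Algebra.Bundles using (CommutativeMonoid)
import Algebra.Properties.CommutativeSemigroup as CommSemigroupProperties

coeff-here : ∀ c v p w → v ≡ w → coeff ((c , v) ∷ p) w ≡ c + coeff p w
coeff-here c v p w v≡w with v ≟W w
... | yes _ = refl
... | no v≢w = contradiction v≡w v≢w

coeff-there : ∀ c v p w → ¬ v ≡ w → coeff ((c , v) ∷ p) w ≡ coeff p w
coeff-there c v p w v≢w with v ≟W w
... | yes v≡w = contradiction v≡w v≢w
... | no _ = refl

coeff-++ : ∀ p q w → coeff (p ++ q) w ≡ coeff p w + coeff q w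
coeff-++ [] q w = sym (+-identityˡ _)
coeff-++ ((c , v) ∷ p) q w with v ≟W w
... | yes _ = trans (cong (c +_) (coeff-++ p q w)) (sym (+-assoc c _ _))
... | no _ = coeff-++ p q w

coeff-scale : ∀ c p w → coeff (scale c p) w ≡ c * coeff p w
coeff-scale c [] w = sym (*-zeroʳ c)
coeff-scale c ((d , v) ∷ p) w with v ≟W w
... | yes _ = trans (cong (c * d +_) (coeff-scale c p w)) (sym (*-distribˡ-+ c d _))
... | no _ = coeff-scale c p w

coeff-lmul-same : ∀ a p w → coeff (lmul a p) (a ∷ w) ≡ coeff p w
coeff-lmul-same a [] w = refl
coeff-lmul-same a ((d , v) ∷ p) w = by-cases (v ≟W w)
  where
  by-cases : Dec (v ≡ w) → coeff (lmul a ((d , v) ∷ p)) (a ∷ w) ≡ coeff ((d , v) ∷ p) w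
  by-cases (yes v≡w) =
    trans (coeff-here d (a ∷ v) _ _ (cong (a ∷_) v≡w))
      (trans (cong (d +_) (coeff-lmul-same a p w)) (sym (coeff-here d v p w v≡w)))
  by-cases (no v≢w) =
    trans (coeff-there d (a ∷ v) _ _ (λ eq → v≢w (List.∷-injectiveʳ eq)))
      (trans (coeff-lmul-same a p w) (sym (coeff-there d v p w v≢w)))

coeff-lmul-other : ∀ a p w → (∀ w′ → ¬ w ≡ a ∷ w′) → coeff (lmul a p) w ≡ 0ℚ
coeff-lmul-other a [] w w≢a∷ = refl
coeff-lmul-other a ((d , v) ∷ p) w w≢a∷ =
  trans (coeff-there d (a ∷ v) _ w (λ eq → w≢a∷ v (sym eq))) (coeff-lmul-other a p w w≢a∷)

-- Coefficientwise equality, wrapped in a record so that Agda can infer the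
-- two sides (the function type p ≈ q does not determine p and q).

infix 4 _≋_
record _≋_ (p q : ℌ) : Set where
  constructor mk≋
  field coeff-≡ : p ≈ q
open _≋_ public

≋-refl : ∀ {p} → p ≋ p
≋-refl = mk≋ λ _ → refl

≋-sym : ∀ {p q} → p ≋ q → q ≋ p
≋-sym e = mk≋ λ w → sym (coeff-≡ e w)

≋-trans : ∀ {p q r} → p ≋ q → q ≋ r → p ≋ r
≋-trans e f = mk≋ λ w → trans (coeff-≡ e w) (coeff-≡ f w)

≡⇒≋ : ∀ {p q} → p ≡ q → p ≋ q
≡⇒≋ refl = ≋-refl

≋-isEquivalence : IsEquivalence _≋_
≋-isEquivalence = record { refl = ≋-refl ; sym = ≋-sym ; trans = ≋-trans }

ℌ-setoid : Setoid _ _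
ℌ-setoid = record { isEquivalence = ≋-isEquivalence }

open import Relation.Binary.Reasoning.Setoid ℌ-setoid

++-cong : ∀ {p p′ q q′} → p ≋ p′ → q ≋ q′ → p ++ q ≋ p′ ++ q′
++-cong {p} {p′} {q} {q′} e f = mk≋ λ w →
  trans (coeff-++ p q w) (trans (cong₂ _+_ (coeff-≡ e w) (coeff-≡ f w)) (sym (coeff-++ p′ q′ w)))

++-comm : ∀ p q → p ++ q ≋ q ++ p
++-comm p q = mk≋ λ w →
  trans (coeff-++ p q w) (trans (+-comm (coeff p w) (coeff q w)) (sym (coeff-++ q p w)))

++-commutativeMonoid : CommutativeMonoid _ _
++-commutativeMonoid = record
  { Carrier = ℌ
  ; _≈_ = _≋_
  ; _∙_ = _++_
  ; ε = []
  ; isCommutativeMonoid = record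
    { isMonoid = record
      { isSemigroup = record
        { isMagma = record { isEquivalence = ≋-isEquivalence ; ∙-cong = ++-cong }
        ; assoc = λ p q r → ≡⇒≋ (List.++-assoc p q r)
        }
      ; identity = (λ _ → ≋-refl) , (λ p → ≡⇒≋ (List.++-identityʳ p))
      }
    ; comm = ++-comm
    }
  }

open CommSemigroupProperties (CommutativeMonoid.commutativeSemigroup ++-commutativeMonoid)
  using (interchange; x∙yz≈y∙xz; x∙yz≈z∙xy)

scale-cong : ∀ c {p q} → p ≋ q → scale c p ≋ scale c q
scale-cong c {p} {q} e = mk≋ λ w →
  trans (coeff-scale c p w) (trans (cong (c *_) (coeff-≡ e w)) (sym (coeff-scale c q w)))

neg-cong : ∀ {p q} → p ≋ q → neg p ≋ neg q
neg-cong = scale-cong (- 1ℚ)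

lmul-cong : ∀ a {p q} → p ≋ q → lmul a p ≋ lmul a q
lmul-cong a {p} {q} e = mk≋ coeffs
  where
  coeffs : lmul a p ≈ lmul a q
  coeffs [] = trans (coeff-lmul-other a p [] λ _ ()) (sym (coeff-lmul-other a q [] λ _ ()))
  coeffs (b ∷ w) with a ≟L b
  ... | yes refl = trans (coeff-lmul-same a p w) (trans (coeff-≡ e w) (sym (coeff-lmul-same a q w)))
  ... | no a≢b = trans (coeff-lmul-other a p (b ∷ w) b≢a) (sym (coeff-lmul-other a q (b ∷ w) b≢a))
    where
    b≢a : ∀ w′ → ¬ b ∷ w ≡ a ∷ w′
    b≢a w′ eq = a≢b (sym (List.∷-injectiveˡ eq))

scale-++ : ∀ c p q → scale c (p ++ q) ≡ scale c p ++ scale c q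
scale-++ c p q = List.map-++ _ p q

lmul-++ : ∀ a p q → lmul a (p ++ q) ≡ lmul a p ++ lmul a q
lmul-++ a p q = List.map-++ _ p q

scale-lmul : ∀ c a p → scale c (lmul a p) ≡ lmul a (scale c p)
scale-lmul c a [] = refl
scale-lmul c a ((d , v) ∷ p) = cong ((c * d , a ∷ v) ∷_) (scale-lmul c a p)

scale-scale : ∀ c d p → scale c (scale d p) ≋ scale (c * d) p
scale-scale c d p = mk≋ λ w →
  trans (coeff-scale c (scale d p) w) (trans (cong (c *_) (coeff-scale d p w))
    (trans (sym (*-assoc c d (coeff p w))) (sym (coeff-scale (c * d) p w))))

scale-comm : ∀ c d p → scale c (scale d p) ≋ scale d (scale c p)
scale-comm c d p = begin
  scale c (scale d p) ≈⟨ scale-scale c d p ⟩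
  scale (c * d) p     ≡⟨ cong (λ e → scale e p) (*-comm c d) ⟩
  scale (d * c) p     ≈⟨ scale-scale d c p ⟨
  scale d (scale c p) ∎

scale-+ : ∀ c d p → scale (c + d) p ≋ scale c p ++ scale d p
scale-+ c d p = mk≋ λ w →
  trans (coeff-scale (c + d) p w) (trans (*-distribʳ-+ (coeff p w) c d)
    (trans (cong₂ _+_ (sym (coeff-scale c p w)) (sym (coeff-scale d p w)))
      (sym (coeff-++ (scale c p) (scale d p) w))))

scale-0 : ∀ p → scale 0ℚ p ≋ []
scale-0 p = mk≋ λ w → trans (coeff-scale 0ℚ p w) (*-zeroˡ (coeff p w))

scale-1 : ∀ p → scale 1ℚ p ≋ p
scale-1 p = mk≋ λ w → trans (coeff-scale 1ℚ p w) (*-identityˡ (coeff p w))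

extend : (Word → ℌ) → ℌ → ℌ
extend f [] = []
extend f ((c , u) ∷ p) = scale c (f u) ++ extend f p

extend-++ : ∀ f p q → extend f (p ++ q) ≡ extend f p ++ extend f q
extend-++ f [] q = refl
extend-++ f ((c , u) ∷ p) q =
  trans (cong (scale c (f u) ++_) (extend-++ f p q)) (sym (List.++-assoc (scale c (f u)) _ _))

extend-scale : ∀ f c p → extend f (scale c p) ≋ scale c (extend f p)
extend-scale f c [] = ≋-refl
extend-scale f c ((d , u) ∷ p) = begin
  scale (c * d) (f u) ++ extend f (scale c p)   ≈⟨ ++-cong (≋-sym (scale-scale c d (f u))) (extend-scale f c p) ⟩
  scale c (scale d (f u)) ++ scale c (extend f p) ≡⟨ scale-++ c (scale d (f u)) (extend f p) ⟨
  scale c (scale d (f u) ++ extend f p)         ∎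

extend-lmul : ∀ f a p → extend f (lmul a p) ≡ extend (λ s → f (a ∷ s)) p
extend-lmul f a [] = refl
extend-lmul f a ((d , u) ∷ p) = cong (scale d (f (a ∷ u)) ++_) (extend-lmul f a p)

extend-cong-map : ∀ {f g} p → (∀ u → f u ≋ g u) → extend f p ≋ extend g p
extend-cong-map [] e = ≋-refl
extend-cong-map ((c , u) ∷ p) e = ++-cong (scale-cong c (e u)) (extend-cong-map p e)

extend-++-map : ∀ f g p → extend (λ s → f s ++ g s) p ≋ extend f p ++ extend g p
extend-++-map f g [] = ≋-refl
extend-++-map f g ((c , u) ∷ p) = begin
  scale c (f u ++ g u) ++ extend (λ s → f s ++ g s) p
    ≈⟨ ++-cong (≡⇒≋ (scale-++ c (f u) (g u))) (extend-++-map f g p) ⟩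
  (scale c (f u) ++ scale c (g u)) ++ (extend f p ++ extend g p)
    ≈⟨ interchange (scale c (f u)) (scale c (g u)) (extend f p) (extend g p) ⟩
  (scale c (f u) ++ extend f p) ++ (scale c (g u) ++ extend g p)
    ∎

extend-scale-map : ∀ d f p → extend (λ s → scale d (f s)) p ≋ scale d (extend f p)
extend-scale-map d f [] = ≋-refl
extend-scale-map d f ((c , u) ∷ p) = begin
  scale c (scale d (f u)) ++ extend (λ s → scale d (f s)) p
    ≈⟨ ++-cong (scale-comm c d (f u)) (extend-scale-map d f p) ⟩
  scale d (scale c (f u)) ++ scale d (extend f p)
    ≡⟨ scale-++ d (scale c (f u)) (extend f p) ⟨
  scale d (scale c (f u) ++ extend f p)
    ∎

extend-lmul-map : ∀ a f p → extend (λ s → lmul a (f s)) p ≡ lmul a (extend f p)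
extend-lmul-map a f [] = refl
extend-lmul-map a f ((c , u) ∷ p) =
  trans (cong₂ _++_ (scale-lmul c a (f u)) (extend-lmul-map a f p))
        (sym (lmul-++ a (scale c (f u)) (extend f p)))

extend-zero-map : ∀ p → extend (λ _ → []) p ≡ []
extend-zero-map [] = refl
extend-zero-map ((c , u) ∷ p) = extend-zero-map p

extend-word : ∀ p → extend word p ≋ p
extend-word [] = ≋-refl
extend-word ((c , u) ∷ p) = mk≋ λ w → by-cases w (u ≟W w)
  where
  by-cases : ∀ w → Dec (u ≡ w) → coeff ((c * 1ℚ , u) ∷ extend word p) w ≡ coeff ((c , u) ∷ p) w
  by-cases w (yes u≡w) =
    trans (coeff-here _ u _ w u≡w)
      (trans (cong₂ _+_ (*-identityʳ c) (coeff-≡ (extend-word p) w)) (sym (coeff-here c u p w u≡w)))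
  by-cases w (no u≢w) =
    trans (coeff-there _ u _ w u≢w) (trans (coeff-≡ (extend-word p) w) (sym (coeff-there c u p w u≢w)))

extend-single : ∀ f u → extend f (word u) ≋ f u
extend-single f u = ≋-trans (≡⇒≋ (List.++-identityʳ (scale 1ℚ (f u)))) (scale-1 (f u))

extend-extend : ∀ f g p → extend g (extend f p) ≋ extend (λ u → extend g (f u)) p
extend-extend f g [] = ≋-refl
extend-extend f g ((c , u) ∷ p) = begin
  extend g (scale c (f u) ++ extend f p)
    ≡⟨ extend-++ g (scale c (f u)) (extend f p) ⟩
  extend g (scale c (f u)) ++ extend g (extend f p)
    ≈⟨ ++-cong (extend-scale g c (f u)) (extend-extend f g p) ⟩
  scale c (extend g (f u)) ++ extend (λ u → extend g (f u)) p
    ∎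

extend-swap : ∀ (g : Word → Word → ℌ) p q →
  extend (λ u → extend (g u) q) p ≋ extend (λ v → extend (λ u → g u v) p) q
extend-swap g [] q = ≡⇒≋ (sym (extend-zero-map q))
extend-swap g ((c , u) ∷ p) q = begin
  scale c (extend (g u) q) ++ extend (λ u → extend (g u) q) p
    ≈⟨ ++-cong (≋-sym (extend-scale-map c (g u) q)) (extend-swap g p q) ⟩
  extend (λ v → scale c (g u v)) q ++ extend (λ v → extend (λ u → g u v) p) q
    ≈⟨ extend-++-map (λ v → scale c (g u v)) (λ v → extend (λ u → g u v) p) q ⟨
  extend (λ v → scale c (g u v) ++ extend (λ u → g u v) p) q
    ∎

remove : Word → ℌ → ℌ
remove v [] = []
remove v ((d , s) ∷ p) with s ≟W v
... | yes _ = remove v p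
... | no _ = (d , s) ∷ remove v p

remove-length : ∀ v p → length (remove v p) ≤ length p
remove-length v [] = z≤n
remove-length v ((d , s) ∷ p) with s ≟W v
... | yes _ = m≤n⇒m≤1+n (remove-length v p)
... | no _ = s≤s (remove-length v p)

remove-head-length : ∀ v c p → length (remove v ((c , v) ∷ p)) ≤ length p
remove-head-length v c p with v ≟W v
... | yes _ = remove-length v p
... | no v≢v = contradiction refl v≢v

coeff-remove-self : ∀ v p → coeff (remove v p) v ≡ 0ℚ
coeff-remove-self v [] = refl
coeff-remove-self v ((d , s) ∷ p) with s ≟W v
... | yes _ = coeff-remove-self v p
... | no s≢v = trans (coeff-there d s (remove v p) v s≢v) (coeff-remove-self v p)

coeff-remove-other : ∀ v p w → ¬ v ≡ w → coeff (remove v p) w ≡ coeff p w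
coeff-remove-other v [] w v≢w = refl
coeff-remove-other v ((d , s) ∷ p) w v≢w with s ≟W v
... | yes refl = trans (coeff-remove-other v p w v≢w) (sym (coeff-there d s p w v≢w))
... | no _ = by-cases (s ≟W w)
  where
  by-cases : Dec (s ≡ w) → coeff ((d , s) ∷ remove v p) w ≡ coeff ((d , s) ∷ p) w
  by-cases (yes s≡w) = trans (coeff-here d s _ w s≡w)
    (trans (cong (d +_) (coeff-remove-other v p w v≢w)) (sym (coeff-here d s p w s≡w)))
  by-cases (no s≢w) = trans (coeff-there d s _ w s≢w)
    (trans (coeff-remove-other v p w v≢w) (sym (coeff-there d s p w s≢w)))

remove-cong : ∀ v {p q} → p ≋ q → remove v p ≋ remove v q
remove-cong v {p} {q} e = mk≋ λ w → by-cases w (v ≟W w)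
  where
  by-cases : ∀ w → Dec (v ≡ w) → coeff (remove v p) w ≡ coeff (remove v q) w
  by-cases w (yes refl) = trans (coeff-remove-self v p) (sym (coeff-remove-self v q))
  by-cases w (no v≢w) =
    trans (coeff-remove-other v p w v≢w) (trans (coeff-≡ e w) (sym (coeff-remove-other v q w v≢w)))

extend-remove : ∀ f v p → extend f p ≋ scale (coeff p v) (f v) ++ extend f (remove v p)
extend-remove f v [] = ≋-sym (≋-trans (≡⇒≋ (List.++-identityʳ (scale 0ℚ (f v)))) (scale-0 (f v)))
extend-remove f v ((d , s) ∷ p) with s ≟W v
... | yes refl = begin
  scale d (f s) ++ extend f p
    ≈⟨ ++-cong ≋-refl (extend-remove f s p) ⟩
  scale d (f s) ++ (scale (coeff p s) (f s) ++ extend f (remove s p))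
    ≡⟨ List.++-assoc (scale d (f s)) (scale (coeff p s) (f s)) _ ⟨
  (scale d (f s) ++ scale (coeff p s) (f s)) ++ extend f (remove s p)
    ≈⟨ ++-cong (scale-+ d (coeff p s) (f s)) ≋-refl ⟨
  scale (d + coeff p s) (f s) ++ extend f (remove s p)
    ∎
... | no _ = begin
  scale d (f s) ++ extend f p
    ≈⟨ ++-cong ≋-refl (extend-remove f v p) ⟩
  scale d (f s) ++ (scale (coeff p v) (f v) ++ extend f (remove v p))
    ≈⟨ x∙yz≈y∙xz (scale d (f s)) (scale (coeff p v) (f v)) _ ⟩
  scale (coeff p v) (f v) ++ (scale d (f s) ++ extend f (remove v p))
    ∎

-- extend f respects ≋, by induction on the total number of terms: split off
-- the word of some first term on both sides and recurse on the remainders.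
extend-cong-bounded : ∀ n f {p q} → length p ℕ.+ length q ≤ n → p ≋ q → extend f p ≋ extend f q

extend-cong-removing : ∀ n f v {p q} → length (remove v p) ℕ.+ length (remove v q) ≤ n →
  p ≋ q → extend f p ≋ extend f q
extend-cong-removing n f v {p} {q} bound e = begin
  extend f p
    ≈⟨ extend-remove f v p ⟩
  scale (coeff p v) (f v) ++ extend f (remove v p)
    ≈⟨ ++-cong (≡⇒≋ (cong (λ c → scale c (f v)) (coeff-≡ e v)))
               (extend-cong-bounded n f bound (remove-cong v e)) ⟩
  scale (coeff q v) (f v) ++ extend f (remove v q)
    ≈⟨ extend-remove f v q ⟨
  extend f q
    ∎

extend-cong-bounded n f {[]} {[]} _ _ = ≋-refl
extend-cong-bounded (suc n) f {(c , v) ∷ p} {q} (s≤s bound) e =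
  extend-cong-removing n f v (≤-trans (+-mono-≤ (remove-head-length v c p) (remove-length v q)) bound) e
extend-cong-bounded (suc n) f {[]} {(c , v) ∷ q} (s≤s bound) e =
  extend-cong-removing n f v (≤-trans (remove-head-length v c q) bound) e

extend-cong : ∀ f {p q} → p ≋ q → extend f p ≋ extend f q
extend-cong f e = extend-cong-bounded _ f ≤-refl e

ConstantFree : ℌ → Set
ConstantFree p = coeff p [] ≡ 0ℚ

extend-agree : ∀ f g X → ConstantFree X → (∀ a s → f (a ∷ s) ≋ g (a ∷ s)) → extend f X ≋ extend g X
extend-agree f g X cf agree = begin
  extend f X                                          ≈⟨ extend-remove f [] X ⟩
  scale (coeff X []) (f []) ++ extend f (remove [] X) ≈⟨ ++-cong (vanishes f) (off-empty X) ⟩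
  [] ++ extend g (remove [] X)                        ≈⟨ ++-cong (vanishes g) ≋-refl ⟨
  scale (coeff X []) (g []) ++ extend g (remove [] X) ≈⟨ extend-remove g [] X ⟨
  extend g X                                          ∎
  where
  vanishes : ∀ h → scale (coeff X []) (h []) ≋ []
  vanishes h = ≋-trans (≡⇒≋ (cong (λ c → scale c (h [])) cf)) (scale-0 (h []))
  off-empty : ∀ Y → extend f (remove [] Y) ≋ extend g (remove [] Y)
  off-empty [] = ≋-refl
  off-empty ((d , []) ∷ Y) = off-empty Y
  off-empty ((d , a ∷ s) ∷ Y) = ++-cong (scale-cong d (agree a s)) (off-empty Y)

shW-[]ʳ : ∀ s → shW s [] ≡ word s
shW-[]ʳ [] = refl
shW-[]ʳ (a ∷ s) = refl

shW-comm : ∀ u v → shW u v ≋ shW v u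
shW-comm [] v = ≡⇒≋ (sym (shW-[]ʳ v))
shW-comm (a ∷ U) [] = ≋-refl
shW-comm (a ∷ U) (b ∷ V) = begin
  lmul a (shW U (b ∷ V)) ++ (lmul b (shW (a ∷ U) V) ++ (C ++ D))
    ≈⟨ ++-cong (lmul-cong a (shW-comm U (b ∷ V)))
               (++-cong (lmul-cong b (shW-comm (a ∷ U) V)) (++-comm C D)) ⟩
  lmul a (shW (b ∷ V) U) ++ (lmul b (shW V (a ∷ U)) ++ (D ++ C))
    ≈⟨ x∙yz≈y∙xz (lmul a (shW (b ∷ V) U)) (lmul b (shW V (a ∷ U))) (D ++ C) ⟩
  lmul b (shW V (a ∷ U)) ++ (lmul a (shW (b ∷ V) U) ++ (D ++ C))
    ∎
  where
  C = neg (δterm U (τ a ∷ b ∷ V))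
  D = neg (δterm V (τ b ∷ a ∷ U))

infixl 7 _⧢ᵉ_
_⧢ᵉ_ : ℌ → ℌ → ℌ
p ⧢ᵉ q = extend (λ u → extend (shW u) q) p

concatMap-extend : ∀ (G : ℚ × Word → ℌ) f p →
  (∀ c u → G (c , u) ≋ scale c (f u)) → concatMap G p ≋ extend f p
concatMap-extend G f [] e = ≋-refl
concatMap-extend G f ((c , u) ∷ p) e = ++-cong (e c u) (concatMap-extend G f p e)

⧢≋⧢ᵉ : ∀ p q → p ⧢ q ≋ p ⧢ᵉ q
⧢≋⧢ᵉ p q = concatMap-extend _ (λ u → extend (shW u) q) p λ c u →
  ≋-trans (concatMap-extend _ (λ v → scale c (shW u v)) q (λ d v → scale-swap c u d v))
          (extend-scale-map c (shW u) q)
  where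
  scale-swap : ∀ c u d v → scale (c * d) (shW u v) ≋ scale d (scale c (shW u v))
  scale-swap c u d v = ≋-trans (≡⇒≋ (cong (λ e → scale e (shW u v)) (*-comm c d)))
                                   (≋-sym (scale-scale d c (shW u v)))

⧢ᵉ-comm : ∀ p q → p ⧢ᵉ q ≋ q ⧢ᵉ p
⧢ᵉ-comm p q = ≋-trans (extend-swap shW p q)
  (extend-cong-map q λ v → extend-cong-map p λ u → shW-comm u v)

δ· : Word → ℌ → ℌ
δ· [] X = X
δ· (_ ∷ _) X = []

half : Letter → Word → ℌ → ℌ
half a U Q = lmul a (extend (shW U) Q) ++ neg (δ· U (lmul (τ a) Q))

halfW : Word → ℌ → ℌ
halfW [] Q = []
halfW (a ∷ U) Q = half a U Q

halfL : ℌ → ℌ → ℌ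
halfL X Q = extend (λ s → halfW s Q) X

cf-++ : ∀ p q → ConstantFree p → ConstantFree q → ConstantFree (p ++ q)
cf-++ p q cp cq = trans (coeff-++ p q []) (trans (cong₂ _+_ cp cq) (+-identityˡ 0ℚ))

cf-scale : ∀ c p → ConstantFree p → ConstantFree (scale c p)
cf-scale c p cp = trans (coeff-scale c p []) (trans (cong (c *_) cp) (*-zeroʳ c))

cf-lmul : ∀ a p → ConstantFree (lmul a p)
cf-lmul a p = coeff-lmul-other a p [] λ _ ()

cf-neg-δterm : ∀ U a t → ConstantFree (neg (δterm U (a ∷ t)))
cf-neg-δterm [] a t = cf-scale (- 1ℚ) (word (a ∷ t)) refl
cf-neg-δterm (_ ∷ _) a t = refl

cf-shW : ∀ a U v → ConstantFree (shW (a ∷ U) v)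
cf-shW a U [] = refl
cf-shW a U (b ∷ V) =
  cf-++ A (B ++ (C ++ D)) (cf-lmul a (shW U (b ∷ V))) (cf-++ B (C ++ D) (cf-lmul b (shW (a ∷ U) V))
    (cf-++ C D (cf-neg-δterm U (τ a) (b ∷ V)) (cf-neg-δterm V (τ b) (a ∷ U))))
  where
  A = lmul a (shW U (b ∷ V))
  B = lmul b (shW (a ∷ U) V)
  C = neg (δterm U (τ a ∷ b ∷ V))
  D = neg (δterm V (τ b ∷ a ∷ U))

cf-half : ∀ a U Q → ConstantFree (half a U Q)
cf-half a [] Q = cf-++ (lmul a (extend (shW []) Q)) (neg (lmul (τ a) Q))
  (cf-lmul a (extend (shW []) Q)) (cf-scale (- 1ℚ) (lmul (τ a) Q) (cf-lmul (τ a) Q))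
cf-half a U@(_ ∷ _) Q = cf-++ (lmul a (extend (shW U) Q)) [] (cf-lmul a (extend (shW U) Q)) refl

δ·-cong : ∀ U {p q} → p ≋ q → δ· U p ≋ δ· U q
δ·-cong [] e = e
δ·-cong (_ ∷ _) e = ≋-refl

extend-δ·-map : ∀ U g X → extend (λ s → δ· U (g s)) X ≋ δ· U (extend g X)
extend-δ·-map [] g X = ≋-refl
extend-δ·-map (_ ∷ _) g X = ≡⇒≋ (extend-zero-map X)

half-cong : ∀ a U {Q Q′} → Q ≋ Q′ → half a U Q ≋ half a U Q′
half-cong a U e =
  ++-cong (lmul-cong a (extend-cong (shW U) e)) (neg-cong (δ·-cong U (lmul-cong (τ a) e)))

half-linear : ∀ a U X → extend (λ s → half a U (word s)) X ≋ half a U X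
half-linear a U X = begin
  extend (λ s → lmul a (extend (shW U) (word s)) ++ neg (δ· U (lmul (τ a) (word s)))) X
    ≈⟨ extend-++-map (λ s → lmul a (extend (shW U) (word s))) (λ s → neg (δ· U (lmul (τ a) (word s)))) X ⟩
  extend (λ s → lmul a (extend (shW U) (word s))) X ++ extend (λ s → neg (δ· U (lmul (τ a) (word s)))) X
    ≈⟨ ++-cong (≡⇒≋ (extend-lmul-map a (λ s → extend (shW U) (word s)) X))
               (extend-scale-map (- 1ℚ) (λ s → δ· U (lmul (τ a) (word s))) X) ⟩
  lmul a (extend (λ s → extend (shW U) (word s)) X) ++ neg (extend (λ s → δ· U (lmul (τ a) (word s))) X)
    ≈⟨ ++-cong (lmul-cong a (extend-cong-map X (extend-single (shW U))))
               (neg-cong (extend-δ·-map U (λ s → lmul (τ a) (word s)) X)) ⟩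
  lmul a (extend (shW U) X) ++ neg (δ· U (extend (λ s → lmul (τ a) (word s)) X))
    ≈⟨ ++-cong ≋-refl (neg-cong (δ·-cong U (≋-trans (≡⇒≋ (extend-lmul-map (τ a) word X))
                                                    (lmul-cong (τ a) (extend-word X))))) ⟩
  half a U X
    ∎

half-++ : ∀ a U X Y → half a U X ++ half a U Y ≋ half a U (X ++ Y)
half-++ a U X Y = begin
  half a U X ++ half a U Y
    ≈⟨ ++-cong (half-linear a U X) (half-linear a U Y) ⟨
  extend (λ s → half a U (word s)) X ++ extend (λ s → half a U (word s)) Y
    ≡⟨ extend-++ (λ s → half a U (word s)) X Y ⟨
  extend (λ s → half a U (word s)) (X ++ Y)
    ≈⟨ half-linear a U (X ++ Y) ⟩
  half a U (X ++ Y)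
    ∎

half-nonempty : ∀ a b V r → half a (b ∷ V) (word r) ≋ lmul a (shW (b ∷ V) r)
half-nonempty a b V r =
  ≋-trans (≡⇒≋ (List.++-identityʳ _)) (lmul-cong a (extend-single (shW (b ∷ V)) r))

δterm-as-δ· : ∀ U a v → δterm U (a ∷ v) ≡ δ· U (lmul a (word v))
δterm-as-δ· [] a v = refl
δterm-as-δ· (_ ∷ _) a v = refl

shuffle-split : ∀ a U b V → shW (a ∷ U) (b ∷ V) ≋ half a U (word (b ∷ V)) ++ half b V (word (a ∷ U))
shuffle-split a U b V = begin
  A ++ (B ++ (C ++ D))                          ≡⟨ List.++-assoc A B (C ++ D) ⟨
  (A ++ B) ++ (C ++ D)                          ≈⟨ interchange A B C D ⟩
  (A ++ C) ++ (B ++ D)                          ≈⟨ ++-cong left right ⟩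
  half a U (word (b ∷ V)) ++ half b V (word (a ∷ U)) ∎
  where
  A = lmul a (shW U (b ∷ V))
  B = lmul b (shW (a ∷ U) V)
  C = neg (δterm U (τ a ∷ b ∷ V))
  D = neg (δterm V (τ b ∷ a ∷ U))
  left : A ++ C ≋ half a U (word (b ∷ V))
  left = ++-cong (lmul-cong a (≋-sym (extend-single (shW U) (b ∷ V))))
                 (≡⇒≋ (cong neg (δterm-as-δ· U (τ a) (b ∷ V))))
  right : B ++ D ≋ half b V (word (a ∷ U))
  right = ++-cong (lmul-cong b (≋-trans (shW-comm (a ∷ U) V) (≋-sym (extend-single (shW V) (a ∷ U)))))
                  (≡⇒≋ (cong neg (δterm-as-δ· V (τ b) (a ∷ U))))

shuffle-split-left : ∀ c W X → ConstantFree X →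
  extend (λ s → shW s (c ∷ W)) X ≋ halfL X (word (c ∷ W)) ++ half c W X
shuffle-split-left c W X cf = begin
  extend (λ s → shW s (c ∷ W)) X
    ≈⟨ extend-agree _ (λ s → halfW s (word (c ∷ W)) ++ half c W (word s)) X cf (λ a s → shuffle-split a s c W) ⟩
  extend (λ s → halfW s (word (c ∷ W)) ++ half c W (word s)) X
    ≈⟨ extend-++-map (λ s → halfW s (word (c ∷ W))) (λ s → half c W (word s)) X ⟩
  halfL X (word (c ∷ W)) ++ extend (λ s → half c W (word s)) X
    ≈⟨ ++-cong ≋-refl (half-linear c W X) ⟩
  halfL X (word (c ∷ W)) ++ half c W X
    ∎

Assoc : Word → Word → Word → Set
Assoc u v t = extend (λ s → shW s t) (shW u v) ≋ extend (shW u) (shW v t)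

zinbiel : ∀ a U b V r → Assoc U (b ∷ V) r →
  halfL (half a U (word (b ∷ V))) (word r) ≋ half a U (shW (b ∷ V) r)
zinbiel a [] b V r _ = begin
  halfL (half a [] (word v)) (word r)
    ≈⟨ extend-cong ≺r (++-cong (lmul-cong a (extend-single (shW []) v)) (≋-refl {neg (word (τ a ∷ v))})) ⟩
  halfL (word (a ∷ v) ++ neg (word (τ a ∷ v))) (word r)
    ≡⟨ extend-++ ≺r (word (a ∷ v)) (neg (word (τ a ∷ v))) ⟩
  halfL (word (a ∷ v)) (word r) ++ halfL (neg (word (τ a ∷ v))) (word r)
    ≈⟨ ++-cong (extend-single ≺r (a ∷ v))
               (≋-trans (extend-scale ≺r (- 1ℚ) (word (τ a ∷ v))) (neg-cong (extend-single ≺r (τ a ∷ v)))) ⟩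
  half a v (word r) ++ neg (half (τ a) v (word r))
    ≈⟨ ++-cong (half-nonempty a b V r) (neg-cong (half-nonempty (τ a) b V r)) ⟩
  lmul a (shW v r) ++ neg (lmul (τ a) (shW v r))
    ≈⟨ ++-cong (lmul-cong a (extend-word (shW v r))) (≋-refl {neg (lmul (τ a) (shW v r))}) ⟨
  half a [] (shW v r)
    ∎
  where
  v = b ∷ V
  ≺r = λ s → halfW s (word r)
zinbiel a U@(u ∷ U′) b V r assoc = begin
  halfL (half a U (word v)) (word r)
    ≈⟨ extend-cong ≺r (half-nonempty a u U′ v) ⟩
  halfL (lmul a (shW U v)) (word r)
    ≡⟨ extend-lmul ≺r a (shW U v) ⟩
  extend (λ s → half a s (word r)) (shW U v)
    ≈⟨ extend-agree (λ s → half a s (word r)) (λ s → lmul a (shW s r)) (shW U v) (cf-shW u U′ v)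
                    (λ b′ s → half-nonempty a b′ s r) ⟩
  extend (λ s → lmul a (shW s r)) (shW U v)
    ≡⟨ extend-lmul-map a (λ s → shW s r) (shW U v) ⟩
  lmul a (extend (λ s → shW s r) (shW U v))
    ≈⟨ lmul-cong a assoc ⟩
  lmul a (extend (shW U) (shW v r))
    ≡⟨ List.++-identityʳ _ ⟨
  half a U (shW v r)
    ∎
  where
  v = b ∷ V
  ≺r = λ s → halfW s (word r)

three-halves : Letter → Word → Letter → Word → Letter → Word → ℌ
three-halves a U b V c W =
  half a U (shW (b ∷ V) (c ∷ W)) ++ (half b V (shW (a ∷ U) (c ∷ W)) ++ half c W (shW (a ∷ U) (b ∷ V)))

three-halves-rotate : ∀ a U b V c W → three-halves b V c W a U ≋ three-halves a U b V c W
three-halves-rotate a U b V c W = begin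
  half b V (shW t u) ++ (half c W (shW v u) ++ half a U (shW v t))
    ≈⟨ x∙yz≈z∙xy (half b V (shW t u)) (half c W (shW v u)) (half a U (shW v t)) ⟩
  half a U (shW v t) ++ (half b V (shW t u) ++ half c W (shW v u))
    ≈⟨ ++-cong (≋-refl {half a U (shW v t)}) (++-cong (half-cong b V (shW-comm t u)) (half-cong c W (shW-comm v u))) ⟩
  half a U (shW v t) ++ (half b V (shW u t) ++ half c W (shW u v))
    ∎
  where
  u = a ∷ U
  v = b ∷ V
  t = c ∷ W

expand : ∀ a U b V c W → Assoc U (b ∷ V) (c ∷ W) → Assoc V (a ∷ U) (c ∷ W) →
  extend (λ s → shW s (c ∷ W)) (shW (a ∷ U) (b ∷ V)) ≋ three-halves a U b V c W
expand a U b V c W assocU assocV = begin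
  extend St (shW u v)
    ≈⟨ extend-cong St (shuffle-split a U b V) ⟩
  extend St (X ++ Y)
    ≡⟨ extend-++ St X Y ⟩
  extend St X ++ extend St Y
    ≈⟨ ++-cong (shuffle-split-left c W X (cf-half a U (word v)))
               (shuffle-split-left c W Y (cf-half b V (word u))) ⟩
  (halfL X (word t) ++ half c W X) ++ (halfL Y (word t) ++ half c W Y)
    ≈⟨ ++-cong (++-cong (zinbiel a U b V t assocU) ≋-refl) (++-cong (zinbiel b V a U t assocV) ≋-refl) ⟩
  (half a U (shW v t) ++ half c W X) ++ (half b V (shW u t) ++ half c W Y)
    ≈⟨ interchange (half a U (shW v t)) (half c W X) (half b V (shW u t)) (half c W Y) ⟩
  (half a U (shW v t) ++ half b V (shW u t)) ++ (half c W X ++ half c W Y)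
    ≈⟨ ++-cong (≋-refl {half a U (shW v t) ++ half b V (shW u t)}) (≋-trans (half-++ c W X Y) (half-cong c W (≋-sym (shuffle-split a U b V)))) ⟩
  (half a U (shW v t) ++ half b V (shW u t)) ++ half c W (shW u v)
    ≡⟨ List.++-assoc (half a U (shW v t)) (half b V (shW u t)) (half c W (shW u v)) ⟩
  three-halves a U b V c W
    ∎
  where
  u = a ∷ U
  v = b ∷ V
  t = c ∷ W
  St = λ s → shW s t
  X = half a U (word v)
  Y = half b V (word u)

sum-swap₁₂ : ∀ i j k → j ℕ.+ suc i ℕ.+ suc k ≡ i ℕ.+ suc j ℕ.+ suc k
sum-swap₁₂ = ℕ-Solver.solve-∀

sum-rotate : ∀ i j k → j ℕ.+ suc k ℕ.+ suc i ≡ i ℕ.+ suc j ℕ.+ suc k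
sum-rotate = ℕ-Solver.solve-∀

sum-reverse : ∀ i j k → k ℕ.+ suc j ℕ.+ suc i ≡ i ℕ.+ suc j ℕ.+ suc k
sum-reverse = ℕ-Solver.solve-∀

assoc-bounded : ∀ n u v t → length u ℕ.+ length v ℕ.+ length t ≤ n → Assoc u v t
assoc-bounded n [] v t _ = ≋-trans (extend-single (λ s → shW s t) v) (≋-sym (extend-word (shW v t)))
assoc-bounded n u@(_ ∷ _) [] t _ = ≋-trans (extend-single (λ s → shW s t) u) (≋-sym (extend-single (shW u) t))
assoc-bounded n u@(_ ∷ _) v@(_ ∷ _) [] _ =
  ≋-trans (≋-trans (extend-cong-map (shW u v) (λ s → ≡⇒≋ (shW-[]ʳ s))) (extend-word (shW u v)))
          (≋-sym (extend-single (shW u) v))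
assoc-bounded (suc n) u@(a ∷ U) v@(b ∷ V) t@(c ∷ W) (s≤s bound) = begin
  extend (λ s → shW s t) (shW u v)  ≈⟨ expand a U b V c W (recurse U v t bound) (recurse V u t bound-VUW) ⟩
  three-halves a U b V c W          ≈⟨ three-halves-rotate a U b V c W ⟨
  three-halves b V c W a U          ≈⟨ expand b V c W a U (recurse V t u bound-VWU) (recurse W v u bound-WVU) ⟨
  extend (λ s → shW s u) (shW v t)  ≈⟨ extend-cong-map (shW v t) (shW-comm u) ⟨
  extend (shW u) (shW v t)          ∎
  where
  recurse : ∀ u′ v′ t′ → length u′ ℕ.+ length v′ ℕ.+ length t′ ≤ n → Assoc u′ v′ t′
  recurse = assoc-bounded n
  i = length U
  j = length V
  k = length W
  bound-VUW : j ℕ.+ suc i ℕ.+ suc k ≤ n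
  bound-VUW = subst (_≤ n) (sym (sum-swap₁₂ i j k)) bound
  bound-VWU : j ℕ.+ suc k ℕ.+ suc i ≤ n
  bound-VWU = subst (_≤ n) (sym (sum-rotate i j k)) bound
  bound-WVU : k ℕ.+ suc j ℕ.+ suc i ≤ n
  bound-WVU = subst (_≤ n) (sym (sum-reverse i j k)) bound

assoc-words : ∀ u v t → Assoc u v t
assoc-words u v t = assoc-bounded _ u v t ≤-refl

⧢ᵉ-assoc : ∀ p q r → (p ⧢ᵉ q) ⧢ᵉ r ≋ p ⧢ᵉ (q ⧢ᵉ r)
⧢ᵉ-assoc p q r = begin
  extend ⧢r (extend (λ u → extend (shW u) q) p)
    ≈⟨ extend-extend (λ u → extend (shW u) q) ⧢r p ⟩
  extend (λ u → extend ⧢r (extend (shW u) q)) p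
    ≈⟨ extend-cong-map p (λ u → extend-extend (shW u) ⧢r q) ⟩
  extend (λ u → extend (λ v → extend ⧢r (shW u v)) q) p
    ≈⟨ extend-cong-map p (λ u → extend-cong-map q (λ v → extend-swap shW (shW u v) r)) ⟩
  extend (λ u → extend (λ v → extend (λ t → extend (λ s → shW s t) (shW u v)) r) q) p
    ≈⟨ extend-cong-map p (λ u → extend-cong-map q (λ v → extend-cong-map r (λ t → assoc-words u v t))) ⟩
  extend (λ u → extend (λ v → extend (λ t → extend (shW u) (shW v t)) r) q) p
    ≈⟨ extend-cong-map p (λ u → extend-cong-map q (λ v → extend-extend (shW v) (shW u) r)) ⟨
  extend (λ u → extend (λ v → extend (shW u) (extend (shW v) r)) q) p
    ≈⟨ extend-cong-map p (λ u → extend-extend (λ v → extend (shW v) r) (shW u) q) ⟨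
  extend (λ u → extend (shW u) (q ⧢ᵉ r)) p
    ∎
  where
  ⧢r = λ s → extend (shW s) r

proposition2p6 : (∀ (p q : ℌ) → p ⧢ q ≈ q ⧢ p)
    × (∀ (p q r : ℌ) → (p ⧢ q) ⧢ r ≈ p ⧢ (q ⧢ r))
proposition2p6 = (λ p q → coeff-≡ (commutative p q)) , (λ p q r → coeff-≡ (associative p q r))
  where
  commutative : ∀ p q → p ⧢ q ≋ q ⧢ p
  commutative p q = begin
    p ⧢ q   ≈⟨ ⧢≋⧢ᵉ p q ⟩
    p ⧢ᵉ q  ≈⟨ ⧢ᵉ-comm p q ⟩
    q ⧢ᵉ p  ≈⟨ ⧢≋⧢ᵉ q p ⟨
    q ⧢ p   ∎
  associative : ∀ p q r → (p ⧢ q) ⧢ r ≋ p ⧢ (q ⧢ r)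
  associative p q r = begin
    (p ⧢ q) ⧢ r    ≈⟨ ⧢≋⧢ᵉ (p ⧢ q) r ⟩
    (p ⧢ q) ⧢ᵉ r   ≈⟨ extend-cong _ (⧢≋⧢ᵉ p q) ⟩
    (p ⧢ᵉ q) ⧢ᵉ r  ≈⟨ ⧢ᵉ-assoc p q r ⟩
    p ⧢ᵉ (q ⧢ᵉ r)  ≈⟨ extend-cong-map p (λ u → extend-cong (shW u) (⧢≋⧢ᵉ q r)) ⟨
    p ⧢ᵉ (q ⧢ r)   ≈⟨ ⧢≋⧢ᵉ p (q ⧢ r) ⟨
    p ⧢ (q ⧢ r)    ∎
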